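{- For all integers $s\ge 2$ and $t \ge 2$: (i) $|EN_{1,t}(231)| = 1$; (ii) $|EN_{s,1}(231)| = 1$; (iii) $|EN_{s,t}(231)| = 0$.
   Context: For positive integers $s,t$, write each $x \in [st]=\{1,\dots,st\}$ uniquely as $x=(j-1)t+r$ with $1\le j\le s$ and $1\le r\le t$. The poset $EN_{s,t}$ is $[st]$ with the partial order $(j-1)t+r \preceq (j'-1)t+r'$ if and only if $j'\le j$ and $r\le r'$. A linear extension of a poset $([n],\preceq)$ is a permutation $\pi=\pi(1)\cdots\pi(n)$ of $[n]$ (one-line notation) such that whenever $a\preceq b$ and $a\ne b$, $a$ appears before $b$ in $\pi$. A permutation $\pi$ contains $\sigma$ if $\pi$ has a subsequence with the same relative order as $\sigma$, and avoids $\sigma$ otherwise. $P(\sigma_1,\dots,\sigma_k)$ denotes the set of linear extensions of the poset $P$ avoiding each $\sigma_i$. -}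

module Defs where

open import Data.Nat using (ℕ; zero; suc; _+_; _*_; _∸_; _≤_; _<_; NonZero)
open import Data.Nat.DivMod using (_/_; _%_)
open import Data.List using (List; upTo; map; length; lookup)
open import Data.List.Relation.Binary.Permutation.Propositional using (_↭_)
open import Data.Fin using (Fin; toℕ)
open import Data.Product using (Σ; ∃; _×_; _,_)
open import Relation.Nullary using (¬_)
open import Relation.Binary.PropositionalEquality using (_≡_)

-- A finite poset on [n] = {1,…,n} given by its order relation on ℕ
-- (only values in [n] matter).

-- For x ∈ [st], x = (j-1)t + r with 1 ≤ j ≤ s, 1 ≤ r ≤ t.
-- Block index j-1 = (x-1) / t and residue r-1 = (x-1) % t.
blk : (t : ℕ) → .{{NonZero t}} → ℕ → ℕ
blk t x = (x ∸ 1) / t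

res : (t : ℕ) → .{{NonZero t}} → ℕ → ℕ
res t x = (x ∸ 1) % t

EN≼ : (t : ℕ) → .{{NonZero t}} → ℕ → ℕ → Set
EN≼ t x y = (blk t y ≤ blk t x) × (res t x ≤ res t y)

IsPermOf : ℕ → List ℕ → Set
IsPermOf n π = π ↭ map suc (upTo n)

AppearsBefore : List ℕ → ℕ → ℕ → Set
AppearsBefore π a b =
  Σ (Fin (length π)) λ i → Σ (Fin (length π)) λ k →
    (toℕ i < toℕ k) × (lookup π i ≡ a) × (lookup π k ≡ b)

IsLinExt : ℕ → (ℕ → ℕ → Set) → List ℕ → Set
IsLinExt n _⪯_ π =
  IsPermOf n π ×
  (∀ a b → 1 ≤ a → a ≤ n → 1 ≤ b → b ≤ n → a ⪯ b → ¬ (a ≡ b) → AppearsBefore π a b)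

Contains231 : List ℕ → Set
Contains231 π =
  Σ (Fin (length π)) λ i → Σ (Fin (length π)) λ j → Σ (Fin (length π)) λ k →
    (toℕ i < toℕ j) × (toℕ j < toℕ k) ×
    (lookup π k < lookup π i) × (lookup π i < lookup π j)

Avoids231 : List ℕ → Set
Avoids231 π = ¬ Contains231 π

InEN231 : (s t : ℕ) → .{{NonZero t}} → List ℕ → Set
InEN231 s t π = IsLinExt (s * t) (EN≼ t) π × Avoids231 π

HasExactlyOne : (List ℕ → Set) → Set
HasExactlyOne X = Σ (List ℕ) λ π → X π × (∀ π' → X π' → π' ≡ π)

IsEmpty : (List ℕ → Set) → Set
IsEmpty X = ∀ π → ¬ X π

-- If the poset is a chain on [n], its only linear extension lists [n] along the chain, and the
-- chains of EN_{1,t} and EN_{s,1} are monotone, so that extension avoids 231.  For s, t ≥ 2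
-- the elements m = (s-1)t+1 ≺ m+1 ≺ t form a chain, and since t < m < m+1 they occur in
-- every linear extension of EN_{s,t} as the pattern 231.
module Submission where

open import Level using (0ℓ)
open import Data.Nat using (ℕ; suc; _+_; _*_; _≤_; _<_; _≥_; NonZero; z≤n; s≤s)
open import Data.Nat.Properties
open import Relation.Binary.PropositionalEquality using (_≡_; _≢_; refl; sym; cong; subst; subst₂; cong₂; ≢-sym; setoid; module ≡-Reasoning)
open import Data.Nat.DivMod using (_/_; _%_; +-distrib-/-∣ʳ; m<n⇒m/n≡0; m*n/n≡m; [m+kn]%n≡m%n; m<n⇒m%n≡m; n/1≡n; n%1≡0)
open import Data.Nat.Divisibility using (divides-refl)
open import Data.Fin using (Fin; toℕ) renaming (zero to fzero; suc to fsuc)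
import Data.Fin.Properties as Fin
open import Data.List using (List; []; _∷_; upTo; map; length; lookup)
open import Data.List.Relation.Binary.Permutation.Propositional using (↭-sym; ↭-trans; ↭⇒↭ₛ)
open import Data.List.Relation.Binary.Permutation.Propositional.Properties using (∈-resp-↭)
open import Data.List.Relation.Binary.Permutation.Setoid.Properties (setoid ℕ) using (Unique-resp-↭)
open import Data.List.Relation.Binary.Pointwise using (Pointwise-≡⇒≡)
import Data.List.Relation.Unary.All as All
open import Data.List.Relation.Unary.Any using (index)
open import Data.List.Relation.Unary.Any.Properties using (lookup-index)
open import Data.List.Relation.Unary.AllPairs using (_∷_)
open import Data.List.Relation.Unary.Linked using (Linked; []; [-]; _∷_)
open import Data.List.Relation.Unary.Unique.Propositional using (Unique)
import Data.List.Relation.Unary.Unique.Propositional.Properties as Unique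
open import Data.List.Membership.Propositional using (_∈_)
open import Data.List.Membership.Propositional.Properties using (∈-lookup; ∈-map⁻; ∈-map⁺; ∈-upTo⁺; ∈-upTo⁻)
import Data.List.Relation.Unary.Sorted.TotalOrder as SortedTotalOrder
import Data.List.Relation.Unary.Sorted.TotalOrder.Properties as Sorted
import Data.List.Sort as Sort
open import Data.Product using (Σ; _×_; _,_)
open import Data.Sum using (inj₁; inj₂)
open import Data.Empty using (⊥-elim)
open import Relation.Nullary using (¬_; yes; no)
open import Relation.Binary.Core using (Rel)
open import Relation.Binary.Bundles using (DecTotalOrder)
open import Relation.Binary.Structures using (IsDecTotalOrder)
open import Relation.Binary.Definitions using (tri<; tri≈; tri>)
open import Relation.Binary.Properties.DecTotalOrder ≤-decTotalOrder using (≥-isDecTotalOrder)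

open import Defs

lookup-injective : ∀ {xs : List ℕ} → Unique xs → ∀ i j → lookup xs i ≡ lookup xs j → i ≡ j
lookup-injective (_ ∷ _) fzero fzero _ = refl
lookup-injective (x∉ ∷ _) fzero (fsuc j) eq = ⊥-elim (All.lookup x∉ (∈-lookup j) eq)
lookup-injective (x∉ ∷ _) (fsuc i) fzero eq = ⊥-elim (All.lookup x∉ (∈-lookup i) (sym eq))
lookup-injective (_ ∷ u) (fsuc i) (fsuc j) eq = cong fsuc (lookup-injective u i j eq)

lookup-index-of : ∀ {xs : List ℕ} {v} → v ∈ xs → Σ (Fin (length xs)) λ i → lookup xs i ≡ v
lookup-index-of v∈ = index v∈ , sym (lookup-index v∈)

Linked-fromLookup : ∀ {R : Rel ℕ 0ℓ} (xs : List ℕ) →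
  (∀ i j → toℕ i < toℕ j → R (lookup xs i) (lookup xs j)) → Linked R xs
Linked-fromLookup [] _ = []
Linked-fromLookup (_ ∷ []) _ = [-]
Linked-fromLookup (_ ∷ y ∷ xs) R-lookup =
  R-lookup fzero (fsuc fzero) (s≤s z≤n) ∷ Linked-fromLookup (y ∷ xs) λ i j i<j → R-lookup (fsuc i) (fsuc j) (s≤s i<j)

module _ {n : ℕ} {π : List ℕ} (π↭[n] : IsPermOf n π) where

  IsPermOf-unique : Unique π
  IsPermOf-unique = Unique-resp-↭ (↭⇒↭ₛ (↭-sym π↭[n])) (Unique.map⁺ suc-injective (Unique.upTo⁺ n))

  IsPermOf-lookup-range : ∀ i → 1 ≤ lookup π i × lookup π i ≤ n
  IsPermOf-lookup-range i with ∈-map⁻ suc (∈-resp-↭ π↭[n] (∈-lookup i))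
  ... | _ , v∈ , πi≡1+v rewrite πi≡1+v = s≤s z≤n , ∈-upTo⁻ v∈

  IsPermOf-∈ : ∀ {v} → 1 ≤ v → v ≤ n → v ∈ π
  IsPermOf-∈ {suc v} _ v≤n = ∈-resp-↭ (↭-sym π↭[n]) (∈-map⁺ suc (∈-upTo⁺ v≤n))

ascending⇒avoids231 : ∀ {π} → (∀ i j → toℕ i ≤ toℕ j → lookup π i ≤ lookup π j) → Avoids231 π
ascending⇒avoids231 mono (i , _ , k , i<j , j<k , πk<πi , _) = <⇒≱ πk<πi (mono i k (<⇒≤ (<-trans i<j j<k)))

descending⇒avoids231 : ∀ {π} → (∀ i j → toℕ i ≤ toℕ j → lookup π j ≤ lookup π i) → Avoids231 π
descending⇒avoids231 mono (i , j , _ , i<j , _ , _ , πi<πj) = <⇒≱ πi<πj (mono i j (<⇒≤ i<j))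

linExt-chain⇒contains231 : ∀ {n _⪯_ π a b c} → IsLinExt n _⪯_ π → 1 ≤ c → b ≤ n →
  a ⪯ b → b ⪯ c → c < a → a < b → Contains231 π
linExt-chain⇒contains231 {n} {_} {π} {a} {b} {c} (π↭[n] , before) 1≤c b≤n a⪯b b⪯c c<a a<b
  with before a b 1≤a a≤n 1≤b b≤n a⪯b (<⇒≢ a<b) | before b c 1≤b b≤n 1≤c c≤n b⪯c (>⇒≢ (<-trans c<a a<b))
  where
  1≤a = ≤-trans 1≤c (<⇒≤ c<a)
  1≤b = ≤-trans 1≤a (<⇒≤ a<b)
  a≤n = ≤-trans (<⇒≤ a<b) b≤n
  c≤n = ≤-trans (<⇒≤ c<a) a≤n
... | i , j , i<j , refl , refl | j' , k , j'<k , πj'≡b , refl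
  with lookup-injective (IsPermOf-unique π↭[n]) j j' (sym πj'≡b)
... | refl = i , j , k , i<j , j'<k , c<a , a<b

module Chain {_≤O_ : Rel ℕ 0ℓ} (isDecTotalOrder : IsDecTotalOrder _≡_ _≤O_)
  (n : ℕ) (_⪯_ : Rel ℕ 0ℓ)
  (⪯⇒≤O : ∀ {a b} → 1 ≤ a → a ≤ n → 1 ≤ b → b ≤ n → a ⪯ b → a ≤O b)
  (≤O⇒⪯ : ∀ {a b} → 1 ≤ a → a ≤ n → 1 ≤ b → b ≤ n → a ≤O b → a ≢ b → a ⪯ b)
  where

  order : DecTotalOrder 0ℓ 0ℓ 0ℓ
  order = record { isDecTotalOrder = isDecTotalOrder }

  open DecTotalOrder order using (totalOrder; total; antisym; reflexive)
  open SortedTotalOrder totalOrder using (Sorted)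
  open Sort order using (sort; sort-↭; sort-↗)

  chain : List ℕ
  chain = sort (map suc (upTo n))

  chain-sorted : Sorted chain
  chain-sorted = sort-↗ _

  chain-lookup-mono : ∀ i j → toℕ i ≤ toℕ j → lookup chain i ≤O lookup chain j
  chain-lookup-mono _ _ = Sorted.lookup-mono-≤ totalOrder chain-sorted

  chain-linExt : IsLinExt n _⪯_ chain
  chain-linExt = sort-↭ _ , before
    where
    before : ∀ a b → 1 ≤ a → a ≤ n → 1 ≤ b → b ≤ n → a ⪯ b → ¬ (a ≡ b) → AppearsBefore chain a b
    before a b 1≤a a≤n 1≤b b≤n a⪯b a≢b
      with lookup-index-of (IsPermOf-∈ (sort-↭ _) 1≤a a≤n) | lookup-index-of (IsPermOf-∈ (sort-↭ _) 1≤b b≤n)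
    ... | i , refl | j , refl with Fin.<-cmp i j
    ... | tri< i<j _ _ = i , j , i<j , refl , refl
    ... | tri≈ _ refl _ = ⊥-elim (a≢b refl)
    ... | tri> _ _ j<i = ⊥-elim (a≢b (antisym (⪯⇒≤O 1≤a a≤n 1≤b b≤n a⪯b)
                                             (chain-lookup-mono j i (<⇒≤ j<i))))

  linExt-sorted : ∀ {π} → IsLinExt n _⪯_ π → Sorted π
  linExt-sorted {π} (π↭[n] , before) = Linked-fromLookup π ≤O-lookup
    where
    ≤O-lookup : ∀ i j → toℕ i < toℕ j → lookup π i ≤O lookup π j
    ≤O-lookup i j i<j with total (lookup π i) (lookup π j) | lookup π i ≟ lookup π j
    ... | inj₁ πi≤πj | _ = πi≤πj
    ... | inj₂ _ | yes πi≡πj = reflexive πi≡πj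
    ... | inj₂ πj≤πi | no πi≢πj
      with IsPermOf-lookup-range π↭[n] i | IsPermOf-lookup-range π↭[n] j
    ... | 1≤πi , πi≤n | 1≤πj , πj≤n
      with before _ _ 1≤πj πj≤n 1≤πi πi≤n (≤O⇒⪯ 1≤πj πj≤n 1≤πi πi≤n πj≤πi (≢-sym πi≢πj)) (≢-sym πi≢πj)
    ... | j' , i' , j'<i' , πj'≡πj , πi'≡πi
      with lookup-injective (IsPermOf-unique π↭[n]) j' j πj'≡πj | lookup-injective (IsPermOf-unique π↭[n]) i' i πi'≡πi
    ... | refl | refl = ⊥-elim (<-asym i<j j'<i')

  linExt-unique : ∀ {π} → IsLinExt n _⪯_ π → π ≡ chain
  linExt-unique {π} π-linExt@(π↭[n] , _) = Pointwise-≡⇒≡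
    (Sorted.↗↭↗⇒≋ totalOrder (linExt-sorted π-linExt) chain-sorted (↭⇒↭ₛ (↭-trans π↭[n] (↭-sym (sort-↭ _)))))

  exactlyOne-linExt : ∀ {P : List ℕ → Set} → P chain → HasExactlyOne (λ π → IsLinExt n _⪯_ π × P π)
  exactlyOne-linExt P-chain = chain , (chain-linExt , P-chain) , λ _ (π-linExt , _) → linExt-unique π-linExt

blk-coords : ∀ t .{{_ : NonZero t}} j {r} → r < t → blk t (suc (j * t + r)) ≡ j
blk-coords t j {r} r<t = begin
  (j * t + r) / t     ≡⟨ cong (_/ t) (+-comm (j * t) r) ⟩
  (r + j * t) / t     ≡⟨ +-distrib-/-∣ʳ r (divides-refl j) ⟩
  r / t + j * t / t   ≡⟨ cong₂ _+_ (m<n⇒m/n≡0 r<t) (m*n/n≡m j t) ⟩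
  j                   ∎
  where open ≡-Reasoning

res-coords : ∀ t .{{_ : NonZero t}} j {r} → r < t → res t (suc (j * t + r)) ≡ r
res-coords t j {r} r<t = begin
  (j * t + r) % t     ≡⟨ cong (_% t) (+-comm (j * t) r) ⟩
  (r + j * t) % t     ≡⟨ [m+kn]%n≡m%n r j t ⟩
  r % t               ≡⟨ m<n⇒m%n≡m r<t ⟩
  r                   ∎
  where open ≡-Reasoning

EN≼-coords : ∀ t .{{_ : NonZero t}} j j' {r r'} → r < t → r' < t → j' ≤ j → r ≤ r' →
  EN≼ t (suc (j * t + r)) (suc (j' * t + r'))
EN≼-coords t j j' r<t r'<t j'≤j r≤r' =
  subst₂ _≤_ (sym (blk-coords t j' r'<t)) (sym (blk-coords t j r<t)) j'≤j ,
  subst₂ _≤_ (sym (res-coords t j r<t)) (sym (res-coords t j' r'<t)) r≤r'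

EN₁-unique231 : ∀ t .{{_ : NonZero t}} → HasExactlyOne (InEN231 1 t)
EN₁-unique231 t = exactlyOne-linExt (ascending⇒avoids231 {chain} chain-lookup-mono)
  where
  in-block₀ : ∀ {a} → suc a ≤ 1 * t → a < t
  in-block₀ a<t = ≤-trans a<t (≤-reflexive (*-identityˡ t))
  ⪯⇒≤ : ∀ {a b} → 1 ≤ a → a ≤ 1 * t → 1 ≤ b → b ≤ 1 * t → EN≼ t a b → a ≤ b
  ⪯⇒≤ {suc a} {suc b} _ a≤t _ b≤t (_ , ra≤rb) =
    s≤s (subst₂ _≤_ (res-coords t 0 (in-block₀ a≤t)) (res-coords t 0 (in-block₀ b≤t)) ra≤rb)
  ≤⇒⪯ : ∀ {a b} → 1 ≤ a → a ≤ 1 * t → 1 ≤ b → b ≤ 1 * t → a ≤ b → a ≢ b → EN≼ t a b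
  ≤⇒⪯ {suc a} {suc b} _ a≤t _ b≤t (s≤s a≤b) _ = EN≼-coords t 0 0 (in-block₀ a≤t) (in-block₀ b≤t) z≤n a≤b
  open Chain ≤-isDecTotalOrder (1 * t) (EN≼ t) ⪯⇒≤ ≤⇒⪯

ENₛ₁-unique231 : ∀ s → HasExactlyOne (InEN231 s 1)
ENₛ₁-unique231 s = exactlyOne-linExt (descending⇒avoids231 {chain} chain-lookup-mono)
  where
  ⪯⇒≥ : ∀ {a b} → 1 ≤ a → a ≤ s * 1 → 1 ≤ b → b ≤ s * 1 → EN≼ 1 a b → a ≥ b
  ⪯⇒≥ {suc a} {suc b} _ _ _ _ (jb≤ja , _) = s≤s (subst₂ _≤_ (n/1≡n b) (n/1≡n a) jb≤ja)
  ≥⇒⪯ : ∀ {a b} → 1 ≤ a → a ≤ s * 1 → 1 ≤ b → b ≤ s * 1 → a ≥ b → a ≢ b → EN≼ 1 a b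
  ≥⇒⪯ {suc a} {suc b} _ _ _ _ (s≤s b≤a) _ =
    subst₂ _≤_ (sym (n/1≡n b)) (sym (n/1≡n a)) b≤a , subst₂ _≤_ (sym (n%1≡0 a)) (sym (n%1≡0 b)) z≤n
  open Chain ≥-isDecTotalOrder (s * 1) (EN≼ 1) ⪯⇒≥ ≥⇒⪯

EN-empty231 : ∀ s t .{{_ : NonZero t}} → 2 ≤ s → 2 ≤ t → IsEmpty (InEN231 s t)
EN-empty231 (suc j) t@(suc (suc r)) (s≤s 1≤j) (s≤s (s≤s _)) π (π-linExt , π-avoids) =
  π-avoids (linExt-chain⇒contains231 π-linExt (s≤s z≤n) m+1≤st m⪯m+1 m+1⪯t t<m (s≤s (+-monoʳ-< (j * t) (n<1+n 0))))
  where
  t≤jt : t ≤ j * t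
  t≤jt = subst (_≤ j * t) (*-identityˡ t) (*-monoˡ-≤ t 1≤j)
  m+1≤st : suc (j * t + 1) ≤ suc j * t
  m+1≤st = subst (λ x → suc x ≤ t + j * t) (+-comm 1 (j * t)) (+-monoˡ-≤ (j * t) (s≤s (s≤s z≤n)))
  m⪯m+1 : EN≼ t (suc (j * t + 0)) (suc (j * t + 1))
  m⪯m+1 = EN≼-coords t j j (s≤s z≤n) (s≤s (s≤s z≤n)) ≤-refl z≤n
  m+1⪯t : EN≼ t (suc (j * t + 1)) (suc (0 * t + suc r))
  m+1⪯t = EN≼-coords t j 0 (s≤s (s≤s z≤n)) ≤-refl z≤n (s≤s z≤n)
  t<m : t < suc (j * t + 0)
  t<m = s≤s (subst (t ≤_) (sym (+-identityʳ (j * t))) t≤jt)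

theorem3p2 : (s t : ℕ) → .{{_ : NonZero t}} → 2 ≤ s → 2 ≤ t →
    HasExactlyOne (InEN231 1 t) × HasExactlyOne (InEN231 s 1) × IsEmpty (InEN231 s t)
theorem3p2 s t 2≤s 2≤t = EN₁-unique231 t , ENₛ₁-unique231 s , EN-empty231 s t 2≤s 2≤t
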